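{- (Trivial fundamental group.) Let $d>1$, let $G$ be a $d$-sphere and let $H$ be a $1$-sphere embedded in $G$. Then $H$ is homotopic to a point, i.e. there is a finite sequence of simple homotopy deformations of $H$ within $G$ transforming $H$ into the empty graph.
   Context: All graphs are finite simple graphs. The unit sphere $S(x)$ of a vertex $x$ is the subgraph generated by its neighbors. $K_1$ is contractible, and $G=(V,E)$ is contractible if some vertex $x$ has $S(x)$ and the subgraph generated by $V\setminus\{x\}$ both contractible. The empty graph is the unique $(-1)$-sphere; $G$ is a $d$-sphere if every $S(x)$ is a $(d-1)$-sphere and for some vertex $x$ the subgraph generated by $V\setminus\{x\}$ is contractible. A $k$-simplex is a complete subgraph $K_{k+1}$. A sphere $H$ is embedded in $G$ if $H$ is a subgraph of $G$ and for all vertices $x_1,\dots,x_k$ of a complete subgraph of $G$, $H\cap\bigcap_j S(x_j)$ is a sphere. A simple homotopy deformation of a $1$-sphere (closed curve) $H$ in $G$: take a triangle ($2$-simplex) $x$ of $G$ containing a nonempty set $Y$ of edges of $H$ and replace the edges in $Y$ by the edges of $x$ not in $Y$; it is also allowed to replace a whole simplex by the empty graph. -}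

module Defs where

open import Data.Nat using (ℕ; zero; suc)
open import Data.Fin using (Fin; _≟_)
open import Data.Bool using (Bool; true; false; _∧_; _∨_; not; _xor_; T)
open import Data.List using (List; []; _∷_)
open import Data.List.Membership.Propositional using (_∈_)
open import Data.Product using (Σ; ∃; _×_; _,_)
open import Data.Sum using (_⊎_)
open import Relation.Nullary using (¬_; does)
open import Relation.Binary.PropositionalEquality using (_≡_; _≢_)

-- A (sub)graph on the ambient vertex type Fin N:
-- a vertex predicate and an edge predicate (Bool-valued, hence decidable).
record Gr (N : ℕ) : Set where
  constructor mkGr
  field
    vert : Fin N → Bool
    edge : Fin N → Fin N → Bool
open Gr public

record IsSimpleGraph {N : ℕ} (G : Gr N) : Set where
  field
    irrefl  : ∀ x → edge G x x ≡ false
    sym     : ∀ x y → edge G x y ≡ edge G y x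
    closed  : ∀ x y → edge G x y ≡ true → (vert G x ≡ true) × (vert G y ≡ true)

_==_ : ∀ {N} → Fin N → Fin N → Bool
x == y = does (x ≟ y)

induced : ∀ {N} → Gr N → (Fin N → Bool) → Gr N
induced G p = mkGr (λ y → vert G y ∧ p y)
                   (λ y z → edge G y z ∧ (vert G y ∧ p y) ∧ (vert G z ∧ p z))

unitSphere : ∀ {N} → Gr N → Fin N → Gr N
unitSphere G x = induced G (λ y → edge G x y)

delete : ∀ {N} → Gr N → Fin N → Gr N
delete G x = induced G (λ y → not (y == x))

_∩_ : ∀ {N} → Gr N → Gr N → Gr N
A ∩ B = mkGr (λ y → vert A y ∧ vert B y) (λ y z → edge A y z ∧ edge B y z)

capSpheres : ∀ {N} → Gr N → Gr N → List (Fin N) → Gr N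
capSpheres G H []       = H
capSpheres G H (x ∷ xs) = capSpheres G H xs ∩ unitSphere G x

-- Contractibility (least fixed point of the recursive definition;
-- well-founded since the number of vertices decreases).
data Contractible {N : ℕ} (G : Gr N) : Set where
  k1   : (x : Fin N) → (∀ y → vert G y ≡ true → y ≡ x) → vert G x ≡ true
       → Contractible G
  step : (x : Fin N) → vert G x ≡ true
       → Contractible (unitSphere G x) → Contractible (delete G x)
       → Contractible G

-- SphereS G k  means: G is a (k - 1)-sphere  (k = 0 is the empty graph).
data SphereS {N : ℕ} (G : Gr N) : ℕ → Set where
  empty : (∀ y → vert G y ≡ false) → SphereS G 0
  step  : ∀ {k} → (∀ x → vert G x ≡ true → SphereS (unitSphere G x) k)
        → (Σ (Fin N) λ x → (vert G x ≡ true) × Contractible (delete G x))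
        → SphereS G (suc k)

IsSphere : ∀ {N} → ℕ → Gr N → Set
IsSphere d G = SphereS G (suc d)

IsSomeSphere : ∀ {N} → Gr N → Set
IsSomeSphere G = ∃ λ k → SphereS G k

Subgraph : ∀ {N} → Gr N → Gr N → Set
Subgraph {N} H G = (∀ x → vert H x ≡ true → vert G x ≡ true)
                 × (∀ x y → edge H x y ≡ true → edge G x y ≡ true)

IsClique : ∀ {N} → Gr N → List (Fin N) → Set
IsClique G xs = (∀ x → x ∈ xs → vert G x ≡ true)
              × (∀ x y → x ∈ xs → y ∈ xs → x ≢ y → edge G x y ≡ true)

Embedded : ∀ {N} → Gr N → Gr N → Set
Embedded H G = Subgraph H G
  × (∀ x xs → IsClique G (x ∷ xs) → IsSomeSphere (capSpheres G H (x ∷ xs)))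

-- Curves are represented by their edge sets.
Curve : ℕ → Set
Curve N = Fin N → Fin N → Bool

samePair : ∀ {N} → Fin N → Fin N → Fin N → Fin N → Bool
samePair a b y z = ((a == y) ∧ (b == z)) ∨ ((a == z) ∧ (b == y))

triEdges : ∀ {N} → Fin N → Fin N → Fin N → Curve N
triEdges a b c y z = samePair a b y z ∨ samePair b c y z ∨ samePair a c y z

IsTriangle : ∀ {N} → Gr N → Fin N → Fin N → Fin N → Set
IsTriangle G a b c = (vert G a ≡ true) × (vert G b ≡ true) × (vert G c ≡ true)
  × (edge G a b ≡ true) × (edge G b c ≡ true) × (edge G a c ≡ true)

-- One simple homotopy deformation step: pick a triangle x = abc of G
-- whose set Y of edges lying on the curve is nonempty, and replace Y by the
-- edges of x not in Y (i.e. symmetric difference with the edges of x).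
-- The case Y = all of x removes the whole simplex.
Deform : ∀ {N} → Gr N → Curve N → Curve N → Set
Deform {N} G C D = Σ (Fin N) λ a → Σ (Fin N) λ b → Σ (Fin N) λ c →
    IsTriangle G a b c
  × ((C a b ≡ true) ⊎ (C b c ≡ true) ⊎ (C a c ≡ true))
  × (∀ y z → D y z ≡ (C y z xor triEdges a b c y z))

data Deforms {N : ℕ} (G : Gr N) : Curve N → Curve N → Set where
  done : ∀ {C} → Deforms G C C
  _∷_  : ∀ {C D E} → Deform G C D → Deforms G D E → Deforms G C E

Contractible-in : ∀ {N} → Gr N → Gr N → Set
Contractible-in G H = Σ (Curve _) λ D → Deforms G (edge H) D × (∀ y z → D y z ≡ false)

module Submission where

-- Curves in a sphere of dimension d ≥ 2 contract: a mod-2 homology argument.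
--
-- A deformation step adds (mod 2) the three sides of a triangle of G to the
-- edge set of the curve.  Hence a curve whose edge set is a sum of triangles
-- of G contracts: deform along a triangle of the sum that meets the current
-- curve; when no triangle meets it, the curve is already empty.  So it is
-- enough to show that (i) in a d-sphere, d ≥ 2, every mod-2 1-cycle is a sum
-- of triangles (H₁ = 0), and (ii) the edge set of a 1-sphere is a 1-cycle.

open import Defs
open import Data.Nat using (ℕ; zero; suc; _≤_; s≤s)
open import Data.Nat.Properties using (suc-injective)
open import Data.Fin using (Fin; _≟_) renaming (zero to fzero; suc to fsuc)
open import Data.Bool using (Bool; true; false; _∧_; _∨_; not; _xor_)
import Data.Bool as Bool
open import Data.Bool.Properties
  using (xor-∧-commutativeRing; xor-same; xor-identityʳ; xor-assoc
        ; ∧-zeroʳ; ∧-identityʳ; ∧-comm; ∨-comm; ¬-not)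
open import Algebra.Bundles using (CommutativeRing)
open import Algebra.Properties.CommutativeSemigroup
  (CommutativeRing.+-commutativeSemigroup xor-∧-commutativeRing) using (interchange; x∙yz≈y∙xz)
open import Data.List using (List; []; _∷_; _++_; map; length)
open import Data.List.Properties using (length-removeAt′)
open import Data.List.Relation.Unary.All using (All; []; _∷_; lookupAny)
import Data.List.Relation.Unary.All as All
open import Data.List.Relation.Unary.All.Properties using (++⁺; ─⁺; map⁺; ¬Any⇒All¬)
open import Data.List.Relation.Unary.Any using (Any; here; there; any?; _─_)
import Data.List.Relation.Unary.Any as Any
open import Data.Product using (Σ; _×_; _,_; proj₁; proj₂)
open import Data.Sum using (_⊎_; inj₁; inj₂; [_,_]′)
open import Data.Empty using (⊥-elim)
open import Function using (_∘_)
open import Relation.Nullary using (¬_; Dec; yes; no)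
open import Relation.Nullary.Decidable using (dec-true; dec-false; _⊎-dec_)
open import Relation.Binary.PropositionalEquality
  using (_≡_; _≢_; refl; sym; trans; cong; cong₂; module ≡-Reasoning)

false≢true : false ≢ true
false≢true ()

∧-elim : ∀ {a b} → a ∧ b ≡ true → (a ≡ true) × (b ≡ true)
∧-elim {true} b≡true = refl , b≡true

∧-intro : ∀ {a b} → a ≡ true → b ≡ true → a ∧ b ≡ true
∧-intro refl refl = refl

∨-elim : ∀ {a b} → a ∨ b ≡ true → (a ≡ true) ⊎ (b ≡ true)
∨-elim {true}  _ = inj₁ refl
∨-elim {false} b≡true = inj₂ b≡true

xor-elim : ∀ {a b} → a xor b ≡ true → (a ≡ true) ⊎ (b ≡ true)
xor-elim {true}  _ = inj₁ refl
xor-elim {false} b≡true = inj₂ b≡true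

xor-cancel : ∀ p q → p xor (q xor p) ≡ q
xor-cancel p q = begin
  p xor (q xor p)  ≡⟨ x∙yz≈y∙xz p q p ⟩
  q xor (p xor p)  ≡⟨ cong (q xor_) (xor-same p) ⟩
  q xor false      ≡⟨ xor-identityʳ q ⟩
  q                ∎
  where open ≡-Reasoning

xor-solve : ∀ {c s t} → c xor s ≡ t → c ≡ s xor t
xor-solve {c} {s} refl = sym (xor-cancel s c)

parity : ∀ {n} → (Fin n → Bool) → Bool
parity {zero}  f = false
parity {suc n} f = f fzero xor parity (f ∘ fsuc)

parity-cong : ∀ {n} {f g : Fin n → Bool} → (∀ i → f i ≡ g i) → parity f ≡ parity g
parity-cong {zero}  _   = refl
parity-cong {suc n} f≗g = cong₂ _xor_ (f≗g fzero) (parity-cong (f≗g ∘ fsuc))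

parity-xor : ∀ {n} (f g : Fin n → Bool) → parity (λ i → f i xor g i) ≡ parity f xor parity g
parity-xor {zero}  f g = refl
parity-xor {suc n} f g =
  trans (cong ((f fzero xor g fzero) xor_) (parity-xor (f ∘ fsuc) (g ∘ fsuc)))
        (interchange (f fzero) (g fzero) (parity (f ∘ fsuc)) (parity (g ∘ fsuc)))

parity-zero : ∀ {n} {f : Fin n → Bool} → (∀ i → f i ≡ false) → parity f ≡ false
parity-zero {zero}  _   = refl
parity-zero {suc n} f≗0 rewrite f≗0 fzero = parity-zero (f≗0 ∘ fsuc)

parity-∧ : ∀ {n} k (f : Fin n → Bool) → parity (λ i → k ∧ f i) ≡ k ∧ parity f
parity-∧ true  f = refl
parity-∧ {n} false f = parity-zero {n} (λ _ → refl)

parity-point : ∀ {n} (a : Fin n) → parity (a ==_) ≡ true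
parity-point {suc n} fzero    = cong not (parity-zero {n} (λ _ → refl))
parity-point {suc n} (fsuc a) = parity-point a

module _ {N : ℕ} where

  ==-refl : (a : Fin N) → (a == a) ≡ true
  ==-refl a = dec-true (a ≟ a) refl

  ==-≢ : {a b : Fin N} → a ≢ b → (a == b) ≡ false
  ==-≢ {a} {b} = dec-false (a ≟ b)

  ==-sound : {a b : Fin N} → (a == b) ≡ true → a ≡ b
  ==-sound {a} {b} a==b with a ≟ b
  ... | yes a≡b = a≡b
  ... | no  _   = ⊥-elim (false≢true a==b)

  concentrated : {Y : Fin N → Bool} {x : Fin N} → (∀ v → Y v ≡ true → v ≡ x)
    → ∀ v → Y v ≡ Y x ∧ (x == v)
  concentrated {Y} {x} only-x v with Y v in Yv
  ... | true with refl ← only-x v Yv = sym (∧-intro Yv (==-refl v))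
  ... | false with x ≟ v
  ...   | yes refl = sym (cong (_∧ true) Yv)
  ...   | no  _    = sym (∧-zeroʳ (Y x))

  parity-concentrated : {Y : Fin N → Bool} {x : Fin N} → (∀ v → Y v ≡ true → v ≡ x)
    → parity Y ≡ Y x
  parity-concentrated {Y} {x} only-x = begin
    parity Y                      ≡⟨ parity-cong (concentrated only-x) ⟩
    parity (λ v → Y x ∧ (x == v)) ≡⟨ parity-∧ (Y x) (x ==_) ⟩
    Y x ∧ parity (x ==_)          ≡⟨ cong (Y x ∧_) (parity-point x) ⟩
    Y x ∧ true                    ≡⟨ ∧-identityʳ (Y x) ⟩
    Y x                           ∎
    where open ≡-Reasoning

  ∂edge : Fin N → Fin N → Fin N → Bool
  ∂edge a b v = (a == v) xor (b == v)

  parity-∂edge : (a b : Fin N) → parity (∂edge a b) ≡ false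
  parity-∂edge a b = trans (parity-xor (a ==_) (b ==_)) (cong₂ _xor_ (parity-point a) (parity-point b))

  parity-∧∂edge : ∀ k (a b : Fin N) → parity (λ v → k ∧ ∂edge a b v) ≡ false
  parity-∧∂edge k a b =
    trans (parity-∧ k (∂edge a b)) (trans (cong (k ∧_) (parity-∂edge a b)) (∧-zeroʳ k))

  ∂edge-true : {a b v : Fin N} → ∂edge a b v ≡ true → (a ≡ v) ⊎ (b ≡ v)
  ∂edge-true e with xor-elim e
  ... | inj₁ a==v = inj₁ (==-sound a==v)
  ... | inj₂ b==v = inj₂ (==-sound b==v)

  induced-simple : {K : Gr N} → IsSimpleGraph K → ∀ p → IsSimpleGraph (induced K p)
  induced-simple {K} sK p = record
    { irrefl = λ x → cong (_∧ _) (IsSimpleGraph.irrefl sK x)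
    ; sym    = λ x y → cong₂ _∧_ (IsSimpleGraph.sym sK x y) (∧-comm (vert K x ∧ p x) (vert K y ∧ p y))
    ; closed = λ x y e → ∧-elim (proj₂ (∧-elim {edge K x y} e))
    }

  edge-≢ : {K : Gr N} → IsSimpleGraph K → {a b : Fin N} → edge K a b ≡ true → a ≢ b
  edge-≢ sK {a} e refl = false≢true (trans (sym (IsSimpleGraph.irrefl sK a)) e)

  edge-sym : {K : Gr N} → IsSimpleGraph K → ∀ {p q} → edge K p q ≡ true → edge K q p ≡ true
  edge-sym sK {p} {q} = trans (IsSimpleGraph.sym sK q p)

  delete-vert : {K : Gr N} {x v : Fin N} → vert K v ≡ true → v ≢ x → vert (delete K x) v ≡ true
  delete-vert v∈K v≢x = ∧-intro v∈K (cong not (==-≢ v≢x))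

  vert-delete : {K : Gr N} {x : Fin N} → vert K x ≡ true
    → ∀ v → vert K v ≡ (x == v) xor vert (delete K x) v
  vert-delete {K} {x} x∈K v with x ≟ v
  ... | yes refl rewrite ==-refl x | x∈K = refl
  ... | no  x≢v  rewrite ==-≢ (x≢v ∘ sym) = sym (∧-identityʳ (vert K v))

  link-vert : {K : Gr N} → IsSimpleGraph K → ∀ x v → vert (unitSphere K x) v ≡ edge K x v
  link-vert {K} sK x v with edge K x v in e
  ... | true  = ∧-intro (proj₂ (IsSimpleGraph.closed sK x v e)) refl
  ... | false = ∧-zeroʳ (vert K v)

  nonempty : {K : Gr N} → Contractible K → Σ (Fin N) λ v → vert K v ≡ true
  nonempty (k1 x _ x∈K)     = x , x∈K
  nonempty (step x x∈K _ _) = x , x∈K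

  -- Connectedness in the sense of mod-2 homology (reduced H₀ = 0): every
  -- 0-chain on K of even parity is the boundary ∂₁ of a list of edges of K.

  Supported : Gr N → (Fin N → Bool) → Set
  Supported K Y = ∀ v → Y v ≡ true → vert K v ≡ true

  EdgeOf : Gr N → Fin N × Fin N → Set
  EdgeOf K e = edge K (proj₁ e) (proj₂ e) ≡ true

  ∂₁ : List (Fin N × Fin N) → Fin N → Bool
  ∂₁ []      v = false
  ∂₁ (e ∷ L) v = ∂edge (proj₁ e) (proj₂ e) v xor ∂₁ L v

  Connected : Gr N → Set
  Connected K = ∀ Y → Supported K Y → parity Y ≡ false
    → Σ (List (Fin N × Fin N)) λ L → All (EdgeOf K) L × (∀ v → ∂₁ L v ≡ Y v)

  supported-delete : {K : Gr N} {x : Fin N} {Y : Fin N → Bool}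
    → Supported K Y → Y x ≡ false → Supported (delete K x) Y
  supported-delete {K} {x} Y⊆K Yx≡false v Yv =
    delete-vert {K} {x} (Y⊆K v Yv) λ { refl → false≢true (trans (sym Yx≡false) Yv) }

  delete-edges : {K : Gr N} {x : Fin N} {L : List (Fin N × Fin N)}
    → All (EdgeOf (delete K x)) L → All (EdgeOf K) L
  delete-edges = All.map (proj₁ ∘ ∧-elim)

  connected-point : {K : Gr N} (x : Fin N) → (∀ v → vert K v ≡ true → v ≡ x) → Connected K
  connected-point x only-x Y Y⊆K even = [] , [] , λ v → sym (Y≡0 v)
    where
    on-x : ∀ v → Y v ≡ true → v ≡ x
    on-x v = only-x v ∘ Y⊆K v
    Y≡0 : ∀ v → Y v ≡ false
    Y≡0 v = trans (concentrated on-x v) (cong (_∧ (x == v)) (trans (sym (parity-concentrated on-x)) even))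

  -- Adding back a vertex x with a neighbour in K - x preserves connectedness:
  -- a chain Y with Y(x) = 1 is first corrected by the boundary of the edge xu.
  connected-extend : {K : Gr N} {x u : Fin N} → IsSimpleGraph K → edge K x u ≡ true
    → Connected (delete K x) → Connected K
  connected-extend {K} {x} {u} sK xu conn Y Y⊆K even with Y x in Yx
  ... | false =
    let (L , L⊆ , ∂L≡Y) = conn Y (supported-delete {K} {x} Y⊆K Yx) even
    in L , delete-edges {K} {x} L⊆ , ∂L≡Y
  ... | true =
    let (L , L⊆ , ∂L≡Y') = conn Y' (supported-delete {K} {x} Y'⊆K Y'x≡false) even'
    in (x , u) ∷ L , xu ∷ delete-edges {K} {x} L⊆ ,
       λ v → trans (cong (∂edge x u v xor_) (∂L≡Y' v)) (xor-cancel (∂edge x u v) (Y v))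
    where
    Y' : Fin N → Bool
    Y' v = Y v xor ∂edge x u v
    Y'⊆K : Supported K Y'
    Y'⊆K v Y'v with xor-elim {Y v} Y'v
    ... | inj₁ Yv = Y⊆K v Yv
    ... | inj₂ ∂v with ∂edge-true {x} {u} {v} ∂v
    ...   | inj₁ refl = proj₁ (IsSimpleGraph.closed sK x u xu)
    ...   | inj₂ refl = proj₂ (IsSimpleGraph.closed sK x u xu)
    Y'x≡false : Y' x ≡ false
    Y'x≡false rewrite Yx | ==-refl x | ==-≢ (edge-≢ sK xu ∘ sym) = refl
    even' : parity Y' ≡ false
    even' = trans (parity-xor Y (∂edge x u)) (cong₂ _xor_ even (parity-∂edge x u))

  contractible-connected : {K : Gr N} → IsSimpleGraph K → Contractible K → Connected K
  contractible-connected sK (k1 x only-x _) = connected-point x only-x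
  contractible-connected {K} sK (step x _ cS cD) =
    let (u , u∈S) = nonempty cS
    in connected-extend sK (proj₂ (∧-elim {vert K u} u∈S)) (contractible-connected (induced-simple sK _) cD)

  -- Spheres of dimension ≥ 1 are connected: for the vertex x with K - x
  -- contractible, the sphere S(x) is nonempty, so x has a neighbour.
  sphere-connected : {K : Gr N} {k : ℕ} → IsSimpleGraph K → SphereS K (suc (suc k)) → Connected K
  sphere-connected {K} sK (step spheres (x , x∈K , cD)) with spheres x x∈K
  ... | step _ (u , u∈S , _) =
    connected-extend sK (proj₂ (∧-elim {vert K u} u∈S)) (contractible-connected (induced-simple sK _) cD)

-- The position of a vertex y relative to three pairwise distinct vertices
-- a, b, c, recorded by the three tests a == y, b == y, c == y.
data Position : Bool → Bool → Bool → Set where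
  at-a : Position true  false false
  at-b : Position false true  false
  at-c : Position false false true
  off  : Position false false false

-- The Boolean identity behind the row formula of a triangle below; it holds
-- in each of the sixteen relative positions of y and z.
row-table : ∀ {ay by cy az bz cz} → Position ay by cy → Position az bz cz
  → ((ay ∧ bz) ∨ (az ∧ by)) ∨ ((by ∧ cz) ∨ (bz ∧ cy)) ∨ ((ay ∧ cz) ∨ (az ∧ cy))
    ≡ (ay ∧ (bz xor cz)) xor (by ∧ (az xor cz)) xor (cy ∧ (az xor bz))
row-table at-a at-a = refl
row-table at-a at-b = refl
row-table at-a at-c = refl
row-table at-a off  = refl
row-table at-b at-a = refl
row-table at-b at-b = refl
row-table at-b at-c = refl
row-table at-b off  = refl
row-table at-c at-a = refl
row-table at-c at-b = refl
row-table at-c at-c = refl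
row-table at-c off  = refl
row-table off  at-a = refl
row-table off  at-b = refl
row-table off  at-c = refl
row-table off  off  = refl

record Tri (N : ℕ) : Set where
  constructor tri
  field
    a b c : Fin N

SamePair : ∀ {N} → Fin N → Fin N → Fin N → Fin N → Set
SamePair a b y z = ((a ≡ y) × (b ≡ z)) ⊎ ((a ≡ z) × (b ≡ y))

swap-pair : ∀ {N} {a b y z : Fin N} → SamePair a b y z → SamePair y z a b
swap-pair (inj₁ (refl , refl)) = inj₁ (refl , refl)
swap-pair (inj₂ (refl , refl)) = inj₂ (refl , refl)

along : ∀ {N} {R : Fin N → Fin N → Set} → (∀ {p q} → R p q → R q p)
  → ∀ {a b y z} → SamePair a b y z → R a b → R y z
along _    (inj₁ (refl , refl)) r = r
along sym' (inj₂ (refl , refl)) r = sym' r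

module _ {N : ℕ} where

  sides : Tri N → Curve N
  sides t = triEdges (Tri.a t) (Tri.b t) (Tri.c t)

  sum : List (Tri N) → Curve N
  sum []      y z = false
  sum (t ∷ T) y z = sides t y z xor sum T y z

  sum-++ : ∀ T U (y z : Fin N) → sum (T ++ U) y z ≡ sum T y z xor sum U y z
  sum-++ []      U y z = refl
  sum-++ (t ∷ T) U y z =
    trans (cong (sides t y z xor_) (sum-++ T U y z)) (sym (xor-assoc (sides t y z) (sum T y z) (sum U y z)))

  TriangleOf : Gr N → Tri N → Set
  TriangleOf K t = IsTriangle K (Tri.a t) (Tri.b t) (Tri.c t)

  position : {a b c : Fin N} → a ≢ b → b ≢ c → a ≢ c
    → ∀ y → Position (a == y) (b == y) (c == y)
  position {a} {b} {c} a≢b b≢c a≢c y with a == y in ay | b == y in by | c == y in cy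
  ... | true  | false | false = at-a
  ... | false | true  | false = at-b
  ... | false | false | true  = at-c
  ... | false | false | false = off
  ... | true  | true  | _     = ⊥-elim (a≢b (trans (==-sound ay) (sym (==-sound by))))
  ... | true  | false | true  = ⊥-elim (a≢c (trans (==-sound ay) (sym (==-sound cy))))
  ... | false | true  | true  = ⊥-elim (b≢c (trans (==-sound by) (sym (==-sound cy))))

  -- Row formula: the sides of a triangle abc meeting y form, as a 0-chain in
  -- z, the boundary of the side opposite to y.
  triangle-row : {a b c : Fin N} → a ≢ b → b ≢ c → a ≢ c → ∀ y z
    → triEdges a b c y z
      ≡ ((a == y) ∧ ∂edge b c z) xor ((b == y) ∧ ∂edge a c z) xor ((c == y) ∧ ∂edge a b z)
  triangle-row a≢b b≢c a≢c y z = row-table (position a≢b b≢c a≢c y) (position a≢b b≢c a≢c z)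

  -- Every vertex meets an even number of sides of a triangle: by the row
  -- formula its degree is a combination of edge boundaries, each even.
  triangle-even : {a b c : Fin N} → a ≢ b → b ≢ c → a ≢ c
    → ∀ y → parity (triEdges a b c y) ≡ false
  triangle-even {a} {b} {c} a≢b b≢c a≢c y =
    trans (parity-cong (triangle-row a≢b b≢c a≢c y))
      (trans (parity-xor A (λ z → B z xor C z))
        (cong₂ _xor_ (parity-∧∂edge (a == y) b c)
          (trans (parity-xor B C)
                 (cong₂ _xor_ (parity-∧∂edge (b == y) a c) (parity-∧∂edge (c == y) a b)))))
    where
    A B C : Fin N → Bool
    A z = (a == y) ∧ ∂edge b c z
    B z = (b == y) ∧ ∂edge a c z
    C z = (c == y) ∧ ∂edge a b z

  cone-row : {x a b : Fin N} → x ≢ a → a ≢ b → x ≢ b → ∀ z → triEdges x a b x z ≡ ∂edge a b z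
  cone-row {x} {a} {b} x≢a a≢b x≢b z
    rewrite triangle-row x≢a a≢b x≢b x z | ==-refl x | ==-≢ (x≢a ∘ sym) | ==-≢ (x≢b ∘ sym)
    = xor-identityʳ (∂edge a b z)

  triangle-distinct : {K : Gr N} {t : Tri N} → IsSimpleGraph K → TriangleOf K t
    → (Tri.a t ≢ Tri.b t) × (Tri.b t ≢ Tri.c t) × (Tri.a t ≢ Tri.c t)
  triangle-distinct sK (_ , _ , _ , ab , bc , ac) = edge-≢ sK ab , edge-≢ sK bc , edge-≢ sK ac

  sides-sym : (t : Tri N) → ∀ y z → sides t y z ≡ sides t z y
  sides-sym (tri a b c) y z = cong₂ _∨_ (pair-sym a b) (cong₂ _∨_ (pair-sym b c) (pair-sym a c))
    where
    pair-sym : ∀ p q → samePair p q y z ≡ samePair p q z y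
    pair-sym p q = ∨-comm ((p == y) ∧ (q == z)) ((p == z) ∧ (q == y))

  samePair-true : {a b y z : Fin N} → samePair a b y z ≡ true → SamePair a b y z
  samePair-true e with ∨-elim e
  ... | inj₁ e₁ = inj₁ (==-sound (proj₁ (∧-elim e₁)) , ==-sound (proj₂ (∧-elim e₁)))
  ... | inj₂ e₂ = inj₂ (==-sound (proj₁ (∧-elim e₂)) , ==-sound (proj₂ (∧-elim e₂)))

  sides-true : (t : Tri N) → ∀ {y z} → sides t y z ≡ true
    → SamePair (Tri.a t) (Tri.b t) y z ⊎ SamePair (Tri.b t) (Tri.c t) y z ⊎ SamePair (Tri.a t) (Tri.c t) y z
  sides-true (tri a b c) e with ∨-elim e
  ... | inj₁ ab = inj₁ (samePair-true ab)
  ... | inj₂ e' with ∨-elim e'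
  ...   | inj₁ bc = inj₂ (inj₁ (samePair-true bc))
  ...   | inj₂ ac = inj₂ (inj₂ (samePair-true ac))

  sides-inside : {K : Gr N} → IsSimpleGraph K → ∀ {t} → TriangleOf K t
    → ∀ {y z} → sides t y z ≡ true → edge K y z ≡ true
  sides-inside sK {t} (_ , _ , _ , ab , bc , ac) e with sides-true t e
  ... | inj₁ p        = along (edge-sym sK) p ab
  ... | inj₂ (inj₁ p) = along (edge-sym sK) p bc
  ... | inj₂ (inj₂ p) = along (edge-sym sK) p ac

  _≈_ : Curve N → Curve N → Set
  C ≈ D = ∀ y z → C y z ≡ D y z

  _⊕_ : Curve N → Curve N → Curve N
  (C ⊕ D) y z = C y z xor D y z

  record IsCycle (K : Gr N) (C : Curve N) : Set where
    field
      symmetric : ∀ y z → C y z ≡ C z y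
      inside    : ∀ y z → C y z ≡ true → edge K y z ≡ true
      even      : ∀ v → parity (C v) ≡ false
  open IsCycle

  cycle-⊕ : {K : Gr N} {C D : Curve N} → IsCycle K C → IsCycle K D → IsCycle K (C ⊕ D)
  cycle-⊕ {C = C} {D} γ δ = record
    { symmetric = λ y z → cong₂ _xor_ (symmetric γ y z) (symmetric δ y z)
    ; inside    = λ y z e → [ inside γ y z , inside δ y z ]′ (xor-elim e)
    ; even      = λ v → trans (parity-xor (C v) (D v)) (cong₂ _xor_ (even γ v) (even δ v))
    }

  triangle-cycle : {K : Gr N} → IsSimpleGraph K → ∀ {t} → TriangleOf K t → IsCycle K (sides t)
  triangle-cycle sK {t} τ =
    let (a≢b , b≢c , a≢c) = triangle-distinct sK τ
    in record
      { symmetric = sides-sym t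
      ; inside    = λ y z → sides-inside sK τ
      ; even      = triangle-even a≢b b≢c a≢c
      }

  sum-cycle : {K : Gr N} → IsSimpleGraph K → ∀ {T} → All (TriangleOf K) T → IsCycle K (sum T)
  sum-cycle sK [] = record
    { symmetric = λ _ _ → refl ; inside = λ _ _ () ; even = λ _ → parity-zero {N} (λ _ → refl) }
  sum-cycle sK (τ ∷ τs) = cycle-⊕ (triangle-cycle sK τ) (sum-cycle sK τs)

  cycle-delete : {K : Gr N} {x : Fin N} {C : Curve N} → IsSimpleGraph K → IsCycle K C
    → (∀ z → C x z ≡ false) → IsCycle (delete K x) C
  cycle-delete {K} {x} {C} sK γ avoids =
    record { symmetric = symmetric γ ; inside = inside' ; even = even γ }
    where
    off-x : ∀ {y z} → C y z ≡ true → y ≢ x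
    off-x {y} {z} e refl = false≢true (trans (sym (avoids z)) e)
    inside' : ∀ y z → C y z ≡ true → edge (delete K x) y z ≡ true
    inside' y z e =
      let yz          = inside γ y z e
          (y∈K , z∈K) = IsSimpleGraph.closed sK y z yz
      in ∧-intro yz (∧-intro (delete-vert {K = K} {x = x} y∈K (off-x e))
                             (delete-vert {K = K} {x = x} z∈K (off-x (trans (symmetric γ z y) e))))

  -- Mod-2 H₁ of K vanishes: every cycle of K is a sum of triangles of K.
  CyclesBound : Gr N → Set
  CyclesBound K = ∀ C → IsCycle K C → Σ (List (Tri N)) λ T → All (TriangleOf K) T × C ≈ sum T

  cyclesBound-point : {K : Gr N} {x : Fin N} → IsSimpleGraph K → (∀ v → vert K v ≡ true → v ≡ x)
    → CyclesBound K
  cyclesBound-point sK only-x C γ = [] , [] , no-edges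
    where
    no-edges : C ≈ sum []
    no-edges y z with C y z in e
    ... | false = refl
    ... | true  =
      let yz          = inside γ y z e
          (y∈K , z∈K) = IsSimpleGraph.closed sK y z yz
      in ⊥-elim (edge-≢ sK yz (trans (only-x y y∈K) (sym (only-x z z∈K))))

  cone : Fin N → Fin N × Fin N → Tri N
  cone x e = tri x (proj₁ e) (proj₂ e)

  sphere-edge : {K : Gr N} {x a b : Fin N} → edge (unitSphere K x) a b ≡ true
    → (vert K a ≡ true) × (vert K b ≡ true)
      × (edge K x a ≡ true) × (edge K a b ≡ true) × (edge K x b ≡ true)
  sphere-edge {K} {x} {a} {b} e =
    let (ab , ends)  = ∧-elim {edge K a b} e
        (a∈S , b∈S) = ∧-elim {vert K a ∧ edge K x a} ends
        (a∈K , xa)  = ∧-elim {vert K a} a∈S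
        (b∈K , xb)  = ∧-elim {vert K b} b∈S
    in a∈K , b∈K , xa , ab , xb

  cone-triangle : {K : Gr N} {x : Fin N} → vert K x ≡ true
    → ∀ {e} → EdgeOf (unitSphere K x) e → TriangleOf K (cone x e)
  cone-triangle {K} {x} x∈K e∈S =
    let (a∈K , b∈K , xa , ab , xb) = sphere-edge {K} {x} e∈S in x∈K , a∈K , b∈K , xa , ab , xb

  cone-triangles : {K : Gr N} {x : Fin N} → vert K x ≡ true
    → ∀ {L} → All (EdgeOf (unitSphere K x)) L → All (TriangleOf K) (map (cone x) L)
  cone-triangles {K} {x} x∈K = map⁺ ∘ All.map (cone-triangle {K} {x} x∈K)

  cone-link : {K : Gr N} {x : Fin N} → IsSimpleGraph K → vert K x ≡ true
    → ∀ {L} → All (EdgeOf (unitSphere K x)) L → ∀ z → sum (map (cone x) L) x z ≡ ∂₁ L z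
  cone-link sK x∈K [] z = refl
  cone-link {K} {x} sK x∈K {e ∷ L} (e∈S ∷ L⊆) z =
    let (x≢a , a≢b , x≢b) = triangle-distinct sK (cone-triangle {K} {x} x∈K {e} e∈S)
    in cong₂ _xor_ (cone-row x≢a a≢b x≢b z) (cone-link sK x∈K L⊆ z)

  link-supported : {K : Gr N} {x : Fin N} {C : Curve N} → IsSimpleGraph K → IsCycle K C
    → Supported (unitSphere K x) (C x)
  link-supported {x = x} sK γ v e = trans (link-vert sK x v) (inside γ x v e)

  cone-off : {K : Gr N} {x : Fin N} {C : Curve N} {L : List (Fin N × Fin N)}
    → IsSimpleGraph K → vert K x ≡ true → IsCycle K C
    → All (EdgeOf (unitSphere K x)) L → (∀ z → ∂₁ L z ≡ C x z)
    → IsCycle (delete K x) (C ⊕ sum (map (cone x) L))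
  cone-off {C = C} sK x∈K γ L⊆ ∂L≡Cx =
    cycle-delete sK (cycle-⊕ γ (sum-cycle sK (cone-triangles x∈K L⊆)))
      λ z → trans (cong (C _ z xor_) (trans (cone-link sK x∈K L⊆ z) (∂L≡Cx z))) (xor-same (C _ z))

  delete-triangles : {K : Gr N} {x : Fin N} {T : List (Tri N)}
    → All (TriangleOf (delete K x)) T → All (TriangleOf K) T
  delete-triangles = All.map λ (a , b , c , ab , bc , ac) →
    proj₁ (∧-elim a) , proj₁ (∧-elim b) , proj₁ (∧-elim c) ,
    proj₁ (∧-elim ab) , proj₁ (∧-elim bc) , proj₁ (∧-elim ac)

  cyclesBound-cone : {K : Gr N} {x : Fin N} → IsSimpleGraph K → vert K x ≡ true
    → Connected (unitSphere K x) → CyclesBound (delete K x) → CyclesBound K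
  cyclesBound-cone {K} {x} sK x∈K connected bound C γ =
    let (L , L⊆ , ∂L≡Cx) = connected (C x) (link-supported sK γ) (even γ x)
        (T , T⊆ , C'≈T)  = bound (C ⊕ sum (map (cone x) L)) (cone-off sK x∈K γ L⊆ ∂L≡Cx)
    in map (cone x) L ++ T ,
       ++⁺ (cone-triangles x∈K L⊆) (delete-triangles {K} {x} T⊆) ,
       λ y z → trans (xor-solve (C'≈T y z)) (sym (sum-++ (map (cone x) L) T y z))

  contractible-cyclesBound : {K : Gr N} → IsSimpleGraph K → Contractible K → CyclesBound K
  contractible-cyclesBound sK (k1 x only-x _) = cyclesBound-point sK only-x
  contractible-cyclesBound sK (step x x∈K cS cD) =
    cyclesBound-cone sK x∈K (contractible-connected (induced-simple sK _) cS)
                            (contractible-cyclesBound (induced-simple sK _) cD)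

  -- Spheres of dimension ≥ 2 have H₁ = 0: some S(x) is a sphere of dimension
  -- ≥ 1, hence connected, and K - x is contractible.
  sphere-cyclesBound : {K : Gr N} {k : ℕ} → IsSimpleGraph K → SphereS K (suc (suc (suc k)))
    → CyclesBound K
  sphere-cyclesBound sK (step spheres (x , x∈K , cD)) =
    cyclesBound-cone sK x∈K (sphere-connected (induced-simple sK _) (spheres x x∈K))
                            (contractible-cyclesBound (induced-simple sK _) cD)

  edgeless-point : {K : Gr N} → Contractible K → (∀ y z → edge K y z ≡ false)
    → Σ (Fin N) λ x → (vert K x ≡ true) × (∀ v → vert K v ≡ true → v ≡ x)
  edgeless-point (k1 x only-x x∈K) _ = x , x∈K , only-x
  edgeless-point {K} (step x _ cS _) no-edge with nonempty cS
  ... | u , u∈S = ⊥-elim (false≢true (trans (sym (no-edge x u)) (proj₂ (∧-elim {vert K u} u∈S))))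

  -- In a 0-sphere no two vertices are adjacent, since all unit spheres are empty.
  zero-sphere-edgeless : {S : Gr N} → SphereS S 1
    → ∀ y w → vert S y ≡ true → vert S w ≡ true → edge S y w ≢ true
  zero-sphere-edgeless (step spheres _) y w y∈S w∈S yw with spheres y y∈S
  ... | empty none = false≢true (trans (sym (none w)) (∧-intro w∈S yw))

  -- A 0-sphere consists of two vertices, so its parity is even.
  zero-sphere-even : {S : Gr N} → SphereS S 1 → parity (vert S) ≡ false
  zero-sphere-even {S} σ@(step _ (x , x∈S , cD)) =
    let (z , z∈S-x , only-z) = edgeless-point cD no-edge
    in begin
      parity (vert S)
        ≡⟨ parity-cong (vert-delete {K = S} {x = x} x∈S) ⟩
      parity (λ v → (x == v) xor vert (delete S x) v)
        ≡⟨ parity-xor (x ==_) (vert (delete S x)) ⟩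
      parity (x ==_) xor parity (vert (delete S x))
        ≡⟨ cong₂ _xor_ (parity-point x) (trans (parity-concentrated only-z) z∈S-x) ⟩
      true xor true
        ≡⟨⟩
      false
        ∎
    where
    open ≡-Reasoning
    no-edge : ∀ y w → edge (delete S x) y w ≡ false
    no-edge y w = ¬-not λ e →
      let (yw , ends) = ∧-elim {edge S y w} e
          (y∈S-x , w∈S-x) = ∧-elim {vert S y ∧ not (y == x)} ends
      in zero-sphere-edgeless σ y w (proj₁ (∧-elim {vert S y} y∈S-x))
                                    (proj₁ (∧-elim {vert S w} w∈S-x)) yw

  -- The edge set of a 1-sphere H in G is a cycle of G: the neighbours of a
  -- vertex of H form a 0-sphere, which has even parity.
  one-sphere-cycle : {G H : Gr N} → IsSimpleGraph H → IsSphere 1 H → Subgraph H G → IsCycle G (edge H)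
  one-sphere-cycle {H = H} sH (step spheres _) (_ , H⊆G) = record
    { symmetric = IsSimpleGraph.sym sH
    ; inside    = H⊆G
    ; even      = degree-even
    }
    where
    degree-even : ∀ v → parity (edge H v) ≡ false
    degree-even v with vert H v in v∈H
    ... | true  = trans (parity-cong (λ z → sym (link-vert sH v z))) (zero-sphere-even (spheres v v∈H))
    ... | false = parity-zero λ z → ¬-not λ vz →
                    false≢true (trans (sym v∈H) (proj₁ (IsSimpleGraph.closed sH v z vz)))

  sum-sym : ∀ T (y z : Fin N) → sum T y z ≡ sum T z y
  sum-sym []      y z = refl
  sum-sym (t ∷ T) y z = cong₂ _xor_ (sides-sym t y z) (sum-sym T y z)

  sum-remove : ∀ {P : Tri N → Set} {T} (p : Any P T) (y z : Fin N)
    → sum T y z ≡ sides (Any.lookup p) y z xor sum (T ─ p) y z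
  sum-remove (here _)             y z = refl
  sum-remove {T = t ∷ T} (there p) y z =
    trans (cong (sides t y z xor_) (sum-remove p y z))
          (x∙yz≈y∙xz (sides t y z) (sides (Any.lookup p) y z) (sum (T ─ p) y z))

  Touches : Curve N → Tri N → Set
  Touches C t =
    (C (Tri.a t) (Tri.b t) ≡ true) ⊎ (C (Tri.b t) (Tri.c t) ≡ true) ⊎ (C (Tri.a t) (Tri.c t) ≡ true)

  touches? : (C : Curve N) (t : Tri N) → Dec (Touches C t)
  touches? C t =
    (C (Tri.a t) (Tri.b t) Bool.≟ true) ⊎-dec
    (C (Tri.b t) (Tri.c t) Bool.≟ true) ⊎-dec
    (C (Tri.a t) (Tri.c t) Bool.≟ true)

  sides-touch : {C : Curve N} → (∀ {p q} → C p q ≡ true → C q p ≡ true)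
    → ∀ t {y z} → sides t y z ≡ true → C y z ≡ true → Touches C t
  sides-touch C-sym t s Cyz with sides-true t s
  ... | inj₁ p        = inj₁ (along C-sym (swap-pair p) Cyz)
  ... | inj₂ (inj₁ p) = inj₂ (inj₁ (along C-sym (swap-pair p) Cyz))
  ... | inj₂ (inj₂ p) = inj₂ (inj₂ (along C-sym (swap-pair p) Cyz))

  untouched-empty : {C : Curve N} {T : List (Tri N)} → All (¬_ ∘ Touches C) T → C ≈ sum T
    → ∀ y z → C y z ≡ false
  untouched-empty {C} {T} none C≈T y z = ¬-not λ Cyz →
    false≢true (trans (sym (disjoint none Cyz)) (trans (sym (C≈T y z)) Cyz))
    where
    C-sym : ∀ {p q} → C p q ≡ true → C q p ≡ true
    C-sym {p} {q} = trans (trans (C≈T q p) (trans (sum-sym T q p) (sym (C≈T p q))))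
    disjoint : ∀ {U} → All (¬_ ∘ Touches C) U → ∀ {y z} → C y z ≡ true → sum U y z ≡ false
    disjoint []               Cyz = refl
    disjoint {t ∷ U} (¬t ∷ ¬U) Cyz =
      cong₂ _xor_ (¬-not λ s → ¬t (sides-touch C-sym t s Cyz)) (disjoint ¬U Cyz)

  ContractsIn : Gr N → Curve N → Set
  ContractsIn G C = Σ (Curve N) λ D → Deforms G C D × (∀ y z → D y z ≡ false)

  deform-along : {G : Gr N} {C : Curve N} {t : Tri N} → TriangleOf G t → Touches C t
    → Deform G C (C ⊕ sides t)
  deform-along {t = t} τ touch = Tri.a t , Tri.b t , Tri.c t , τ , touch , λ y z → refl

  sum-remove-⊕ : ∀ {P : Tri N → Set} {T} {C : Curve N} (p : Any P T) → C ≈ sum T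
    → (C ⊕ sides (Any.lookup p)) ≈ sum (T ─ p)
  sum-remove-⊕ {T = T} {C} p C≈T y z = begin
    C y z xor s                   ≡⟨ cong (_xor s) (trans (C≈T y z) (sum-remove p y z)) ⟩
    (s xor sum (T ─ p) y z) xor s ≡⟨ xor-assoc s (sum (T ─ p) y z) s ⟩
    s xor (sum (T ─ p) y z xor s) ≡⟨ xor-cancel s (sum (T ─ p) y z) ⟩
    sum (T ─ p) y z               ∎
    where
    open ≡-Reasoning
    s : Bool
    s = sides (Any.lookup p) y z

  length-─ : ∀ {P : Tri N → Set} {T n} (p : Any P T) → length T ≡ suc n → length (T ─ p) ≡ n
  length-─ {T = T} p len = suc-injective (trans (sym (length-removeAt′ T (Any.index p))) len)

  -- A sum of n triangles of G contracts: deform along a triangle which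
  -- touches the curve, as long as there is one.
  sum-contracts : {G : Gr N} → ∀ n {T} → length T ≡ n → All (TriangleOf G) T
    → ∀ C → C ≈ sum T → ContractsIn G C
  sum-contracts zero {[]} _ [] C C≈0 = C , done , C≈0
  sum-contracts (suc n) {T} len T⊆G C C≈T with any? (touches? C) T
  ... | no ¬any = C , done , untouched-empty (¬Any⇒All¬ T ¬any) C≈T
  ... | yes p =
    let (τ , touch)       = lookupAny T⊆G p
        (D , steps , D≡0) = sum-contracts n (length-─ p len) (─⁺ p T⊆G)
                              (C ⊕ sides (Any.lookup p)) (sum-remove-⊕ p C≈T)
    in D , deform-along τ touch ∷ steps , D≡0

  cycle-contracts : {G : Gr N} {C : Curve N} → CyclesBound G → IsCycle G C → ContractsIn G C
  cycle-contracts {C = C} bound γ =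
    let (T , T⊆G , C≈T) = bound C γ in sum-contracts (length T) refl T⊆G C C≈T

-- The theorem: G has H₁ = 0 as a sphere of dimension ≥ 2, and H, as a
-- 1-sphere contained in G, is a cycle of G; only the subgraph part of the
-- embedding hypothesis is needed.
mainTheorem3 : (N d : ℕ) → 2 ≤ d → (G H : Gr N)
    → IsSimpleGraph G → IsSphere d G
    → IsSimpleGraph H → IsSphere 1 H → Embedded H G
    → Contractible-in G H
mainTheorem3 N d (s≤s (s≤s _)) G H simpleG sphereG simpleH sphereH (H⊆G , _) =
  cycle-contracts (sphere-cyclesBound simpleG sphereG) (one-sphere-cycle simpleH sphereH H⊆G)
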